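{- For every integer $n\geq 1$, the number of Fishburn permutations of length $n$ that avoid both classical patterns $321$ and $31524$ equals $\frac{P_n+P_{n-1}+1}{2}$, where $P_n$ denotes the Pell numbers, defined by $P_0=0$, $P_1=1$ and $P_n=2P_{n-1}+P_{n-2}$ for $n\geq 2$.
   Context: A permutation of length $n$ is a rearrangement $\pi=\pi_1\cdots\pi_n$ of $[n]$. A permutation $\pi$ contains a classical pattern $p\in S_k$ if some subsequence of $\pi$ of length $k$ is order-isomorphic to $p$; otherwise it avoids $p$. A Fishburn permutation is a permutation $\pi$ for which there are no indices $i<j$ with $\pi_j<\pi_i<\pi_{i+1}$ and $\pi_i=\pi_j+1$. -}

module Defs where

open import Data.Nat using (ℕ; zero; suc; _+_; _*_; _∸_)
open import Data.Fin using (Fin; toℕ; suc; zero) renaming (_<_ to _<ᶠ_)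
open import Data.Fin.Patterns
open import Data.Product using (Σ; _×_; ∃; _,_)
import Data.Fin
import Relation.Binary.PropositionalEquality
open import Data.Empty using (⊥)
open import Relation.Nullary using (¬_)
open import Relation.Binary.PropositionalEquality using (_≡_)
open import Function.Bundles using (_⇔_)
open import Function.Definitions using (Injective)
open import Data.List using (List; length)
open import Data.List.Relation.Unary.All using (All)
open import Data.List.Relation.Unary.Any using (Any)
open import Data.List.Relation.Unary.AllPairs using (AllPairs)

-- A permutation of length n: an injective (hence bijective) map Fin n → Fin n,
-- π i is the value at position i (0-based positions and values).
Perm : ℕ → Set
Perm n = Σ (Fin n → Fin n) (λ f → Injective _≡_ _≡_ f)

-- pointwise equality of maps (identity of permutations, no funext needed)
_≗ₚ_ : ∀ {n} → Perm n → Perm n → Set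
(f , _) ≗ₚ (g , _) = ∀ i → f i ≡ g i

HasCount : ∀ n → (Perm n → Set) → ℕ → Set
HasCount n P c = Σ (List (Perm n)) λ L →
  (length L ≡ c) ×
  All P L ×
  AllPairs (λ σ τ → ¬ (σ ≗ₚ τ)) L ×
  (∀ π → P π → Any (λ σ → σ ≗ₚ π) L)

Contains : ∀ {k n} → Perm k → Perm n → Set
Contains {k} {n} (p , _) (π , _) =
  Σ (Fin k → Fin n) λ ι →
    (∀ a b → a <ᶠ b → ι a <ᶠ ι b) ×
    (∀ a b → (p a <ᶠ p b) ⇔ (π (ι a) <ᶠ π (ι b)))

Avoids : ∀ {k n} → Perm k → Perm n → Set
Avoids p π = ¬ Contains p π

Fishburn : ∀ {n} → Perm n → Set
Fishburn {zero} _ = ⊥ → ⊥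
Fishburn {suc m} (π , _) =
  ∀ (i : Fin m) (j : Fin (suc m)) →
    Data.Fin.inject₁ i <ᶠ j →
    π (Data.Fin.inject₁ i) <ᶠ π (suc i) →
    ¬ (toℕ (π (Data.Fin.inject₁ i)) ≡ suc (toℕ (π j)))

p321-fun : Fin 3 → Fin 3
p321-fun 0F = 2F
p321-fun 1F = 1F
p321-fun 2F = 0F

p321-inj : Injective _≡_ _≡_ p321-fun
p321-inj {0F} {0F} _ = _≡_.refl
p321-inj {1F} {1F} _ = _≡_.refl
p321-inj {2F} {2F} _ = _≡_.refl
p321-inj {0F} {1F} ()
p321-inj {0F} {2F} ()
p321-inj {1F} {0F} ()
p321-inj {1F} {2F} ()
p321-inj {2F} {0F} ()
p321-inj {2F} {1F} ()

p321 : Perm 3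
p321 = p321-fun , p321-inj

-- 31524 (1-based) = 2 0 4 1 3 (0-based)
p31524-fun : Fin 5 → Fin 5
p31524-fun 0F = 2F
p31524-fun 1F = 0F
p31524-fun 2F = 4F
p31524-fun 3F = 1F
p31524-fun 4F = 3F

p31524-inv : Fin 5 → Fin 5
p31524-inv 0F = 1F
p31524-inv 1F = 3F
p31524-inv 2F = 0F
p31524-inv 3F = 4F
p31524-inv 4F = 2F

p31524-invl : ∀ x → p31524-inv (p31524-fun x) ≡ x
p31524-invl 0F = _≡_.refl
p31524-invl 1F = _≡_.refl
p31524-invl 2F = _≡_.refl
p31524-invl 3F = _≡_.refl
p31524-invl 4F = _≡_.refl

p31524-inj : Injective _≡_ _≡_ p31524-fun
p31524-inj {x} {y} e =
  Relation.Binary.PropositionalEquality.trans (Relation.Binary.PropositionalEquality.sym (p31524-invl x))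
    (Relation.Binary.PropositionalEquality.trans (Relation.Binary.PropositionalEquality.cong p31524-inv e) (p31524-invl y))

p31524 : Perm 5
p31524 = p31524-fun , p31524-inj

pell : ℕ → ℕ
pell 0 = 0
pell 1 = 1
pell (suc (suc n)) = 2 * pell (suc n) + pell n

-- Members of the class grow by appending a last entry u, the old entries ≥ u moving up by
-- one; deleting the last entry and standardising recovers the parent, so every member of
-- length k + 2 arises exactly once from one of length k + 1. Appending u stays in the class
-- iff u is an active site, i.e. u is not the 1 of a new 321, the bottom of a new Fishburn
-- pattern or the 4 of a new 31524. A member of length k + 1 has two or three active sites:
-- k and k + 1 for the identity; otherwise the top t of a descent and k + 1, together with k
-- when the last entry is maximal. Appending to a permutation of each kind gives, with I the
-- identity, T two sites and R three: I → I + T, T → R + T, R → R + 2T. Hence length k + 1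
-- has 1, P_k and P_0 + ⋯ + P_(k-1) of the three kinds, and 2(1 + P_k + Σ_(i<k) P_i) =
-- P_(k+1) + P_k + 1.

module Submission where

open import Defs
open import Data.Nat using (ℕ; zero; suc; _+_; _*_; _∸_; _≤_; _<_; z≤n; s≤s; _<?_; _≤?_; _≟_; pred)
open import Data.Nat.Properties
open import Data.Nat.DivMod using (_/_; m*n/n≡m)
open import Data.Nat.Tactic.RingSolver using (solve-∀)
open import Data.Fin using (Fin; toℕ; fromℕ<; inject₁) renaming (zero to fzero; suc to fsuc; _<_ to _<ᶠ_)
open import Data.Fin.Patterns
open import Data.Fin.Properties using (toℕ-injective; toℕ<n; fromℕ<-toℕ; toℕ-fromℕ<; toℕ-inject₁)
open import Data.Product using (_×_; _,_; Σ; proj₁; proj₂)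
open import Data.Sum using (inj₁; inj₂)
open import Data.Empty using (⊥; ⊥-elim)
open import Data.List using (List; []; _∷_; _++_; concatMap; map; length)
open import Data.List.Properties using (length-map)
open import Data.List.Relation.Unary.Any using (Any; here; there)
import Data.List.Relation.Unary.Any as Any
import Data.List.Relation.Unary.Any.Properties as Any
open import Data.List.Relation.Unary.All using (All; []; _∷_)
import Data.List.Relation.Unary.All as All
import Data.List.Relation.Unary.All.Properties as All
open import Data.List.Relation.Unary.AllPairs using (AllPairs; []; _∷_)
import Data.List.Relation.Unary.AllPairs as AllPairs
import Data.List.Relation.Unary.AllPairs.Properties as AllPairs
open import Relation.Nullary using (¬_; yes; no)
open import Relation.Binary using (tri<; tri≈; tri>)
open import Relation.Binary.PropositionalEquality
open import Function using (_∘_)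
open import Function.Bundles using (_⇔_; mk⇔; Equivalence)
open import Function.Definitions using (Injective)

shift : ℕ → ℕ → ℕ
shift u x with x <? u
... | yes _ = x
... | no _ = suc x

data ShiftView (u x : ℕ) : Set where
  below : x < u → shift u x ≡ x → ShiftView u x
  above : u ≤ x → shift u x ≡ suc x → ShiftView u x

shift-< : ∀ {u x} → x < u → shift u x ≡ x
shift-< {u} {x} x<u with x <? u
... | yes _ = refl
... | no x≮u = ⊥-elim (x≮u x<u)

shift-≥ : ∀ {u x} → u ≤ x → shift u x ≡ suc x
shift-≥ {u} {x} u≤x with x <? u
... | yes x<u = ⊥-elim (<⇒≱ x<u u≤x)
... | no _ = refl

shift-view : ∀ u x → ShiftView u x
shift-view u x with x <? u
... | yes x<u = below x<u (shift-< x<u)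
... | no x≮u = above (≮⇒≥ x≮u) (shift-≥ (≮⇒≥ x≮u))

shift-mono-< : ∀ {u x y} → x < y → shift u x < shift u y
shift-mono-< {u} {x} {y} x<y with shift-view u x | shift-view u y
... | below _ ex | below _ ey rewrite ex | ey = x<y
... | below _ ex | above _ ey rewrite ex | ey = m<n⇒m<1+n x<y
... | above u≤x _ | below y<u _ = ⊥-elim (<⇒≱ y<u (≤-trans u≤x (<⇒≤ x<y)))
... | above _ ex | above _ ey rewrite ex | ey = s≤s x<y

shift-mono-≤ : ∀ {u x y} → x ≤ y → shift u x ≤ shift u y
shift-mono-≤ x≤y with m≤n⇒m<n∨m≡n x≤y
... | inj₁ x<y = <⇒≤ (shift-mono-< x<y)
... | inj₂ refl = ≤-refl

shift-cancel-< : ∀ {u x y} → shift u x < shift u y → x < y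
shift-cancel-< {u} {x} {y} lt with x <? y
... | yes x<y = x<y
... | no x≮y = ⊥-elim (<⇒≱ lt (shift-mono-≤ (≮⇒≥ x≮y)))

shift-injective : ∀ {u x y} → shift u x ≡ shift u y → x ≡ y
shift-injective {u} {x} {y} eq with <-cmp x y
... | tri< x<y _ _ = ⊥-elim (<⇒≢ (shift-mono-< x<y) eq)
... | tri≈ _ x≡y _ = x≡y
... | tri> _ _ y<x = ⊥-elim (<⇒≢ (shift-mono-< y<x) (sym eq))

shift-≢ : ∀ {u x} → shift u x ≢ u
shift-≢ {u} {x} with shift-view u x
... | below x<u ex = λ eq → <⇒≢ x<u (trans (sym ex) eq)
... | above u≤x ex = λ eq → <⇒≢ (s≤s u≤x) (sym (trans (sym ex) eq))

shift<⇒< : ∀ {u x} → shift u x < u → x < u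
shift<⇒< {u} {x} lt with shift-view u x
... | below x<u _ = x<u
... | above u≤x ex rewrite ex = ⊥-elim (<⇒≱ lt (m≤n⇒m≤1+n u≤x))

shift≤⇒< : ∀ {u x} → shift u x ≤ u → x < u
shift≤⇒< le = shift<⇒< (≤∧≢⇒< le shift-≢)

shift>⇒≥ : ∀ {u x} → u < shift u x → u ≤ x
shift>⇒≥ {u} {x} gt with shift-view u x
... | below x<u ex rewrite ex = ⊥-elim (<-asym x<u gt)
... | above u≤x _ = u≤x

x≤shift : ∀ {u x} → x ≤ shift u x
x≤shift {u} {x} with shift-view u x
... | below _ ex = ≤-reflexive (sym ex)
... | above _ ex = subst (x ≤_) (sym ex) (n≤1+n x)

shift≤suc : ∀ {u x} → shift u x ≤ suc x
shift≤suc {u} {x} with shift-view u x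
... | below _ ex = subst (_≤ suc x) (sym ex) (n≤1+n x)
... | above _ ex = ≤-reflexive ex

shift<suc : ∀ {u x n} → x < n → shift u x < suc n
shift<suc x<n = ≤-<-trans shift≤suc (s≤s x<n)

shift≡suc⇒≡ : ∀ {u x} → shift u x ≡ suc u → x ≡ u
shift≡suc⇒≡ {u} {x} eq with shift-view u x
... | below x<u ex = ⊥-elim (<⇒≢ (m<n⇒m<1+n x<u) (trans (sym ex) eq))
... | above _ ex = suc-injective (trans (sym ex) eq)

shift-reflects-suc : ∀ {u x y} → shift u x ≡ suc (shift u y) → x ≡ suc y
shift-reflects-suc {u} {x} {y} eq with shift-view u x | shift-view u y
... | below _ ex | below _ ey rewrite ex | ey = eq
... | below x<u ex | above u≤y ey rewrite ex | ey =
  ⊥-elim (<⇒≱ x<u (≤-trans u≤y (≤-trans (n≤1+n y) (≤-trans (n≤1+n (suc y)) (≤-reflexive (sym eq))))))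
... | above u≤x ex | below y<u ey rewrite ex | ey = ⊥-elim (<⇒≱ y<u (≤-trans u≤x (≤-reflexive (suc-injective eq))))
... | above _ ex | above _ ey rewrite ex | ey = suc-injective eq

unshift : ℕ → ℕ → ℕ
unshift u x with x <? u
... | yes _ = x
... | no _ = pred x

shift-unshift : ∀ {u x} → x ≢ u → shift u (unshift u x) ≡ x
shift-unshift {u} {x} x≢u with x <? u
... | yes x<u = shift-< x<u
shift-unshift {u} {zero} x≢u | no x≮u = ⊥-elim (x≢u (sym (n≤0⇒n≡0 (≮⇒≥ x≮u))))
shift-unshift {u} {suc x} x≢u | no x≮u = shift-≥ (≤-pred (≤∧≢⇒< (≮⇒≥ x≮u) (x≢u ∘ sym)))

unshift-< : ∀ {u x n} → u ≤ n → x < suc n → x ≢ u → unshift u x < n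
unshift-< {u} {x} u≤n x<1+n x≢u with x <? u
... | yes x<u = <-≤-trans x<u u≤n
unshift-< {u} {zero} u≤n x<1+n x≢u | no x≮u = ⊥-elim (x≢u (sym (n≤0⇒n≡0 (≮⇒≥ x≮u))))
unshift-< {u} {suc x} u≤n x<1+n x≢u | no x≮u = ≤-pred x<1+n

-- Permutations as functions on ℕ

Agree : ℕ → (ℕ → ℕ) → (ℕ → ℕ) → Set
Agree n f g = ∀ i → i < n → f i ≡ g i

Agree-sym : ∀ {n f g} → Agree n f g → Agree n g f
Agree-sym f≐g i i<n = sym (f≐g i i<n)

Agree-trans : ∀ {n f g h} → Agree n f g → Agree n g h → Agree n f h
Agree-trans f≐g g≐h i i<n = trans (f≐g i i<n) (g≐h i i<n)

IsPerm : ℕ → (ℕ → ℕ) → Set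
IsPerm n f = (∀ i → i < n → f i < n) × (∀ i j → i < n → j < n → f i ≡ f j → i ≡ j)

IsFishburn : ℕ → (ℕ → ℕ) → Set
IsFishburn n f = ∀ i j → i < j → j < n → suc i < n → f i < f (suc i) → f i ≡ suc (f j) → ⊥

Avoids321 : ℕ → (ℕ → ℕ) → Set
Avoids321 n f = ∀ i j k → i < j → j < k → k < n → f j < f i → f k < f j → ⊥

Avoids31524 : ℕ → (ℕ → ℕ) → Set
Avoids31524 n f = ∀ a b c d e → a < b → b < c → c < d → d < e → e < n →
  f b < f d → f d < f a → f a < f e → f e < f c → ⊥

InClass : ℕ → (ℕ → ℕ) → Set
InClass n f = IsFishburn n f × Avoids321 n f × Avoids31524 n f

InClass-cong : ∀ {n f g} → Agree n f g → InClass n f → InClass n g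
InClass-cong {n} {f} {g} f≐g (fish , av321 , av31524) = fish′ , av321′ , av31524′
  where
    lt : ∀ {i j} → i < n → j < n → g i < g j → f i < f j
    lt i<n j<n = subst₂ _<_ (sym (f≐g _ i<n)) (sym (f≐g _ j<n))
    fish′ : IsFishburn n g
    fish′ i j i<j j<n si<n up eq = fish i j i<j j<n si<n (lt i<n si<n up)
      (trans (f≐g i i<n) (trans eq (cong suc (sym (f≐g j j<n)))))
      where i<n = <-trans i<j j<n
    av321′ : Avoids321 n g
    av321′ i j k i<j j<k k<n v₁ v₂ = av321 i j k i<j j<k k<n (lt j<n i<n v₁) (lt k<n j<n v₂)
      where
        j<n = <-trans j<k k<n
        i<n = <-trans i<j j<n
    av31524′ : Avoids31524 n g
    av31524′ a b c d e a<b b<c c<d d<e e<n v₁ v₂ v₃ v₄ =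
      av31524 a b c d e a<b b<c c<d d<e e<n (lt b<n d<n v₁) (lt d<n a<n v₂) (lt a<n e<n v₃) (lt e<n c<n v₄)
      where
        d<n = <-trans d<e e<n
        c<n = <-trans c<d d<n
        b<n = <-trans b<c c<n
        a<n = <-trans a<b b<n

append : ℕ → (ℕ → ℕ) → ℕ → ℕ → ℕ
append n f u i with i <? n
... | yes _ = shift u (f i)
... | no _ = u

append-old : ∀ {n f u i} → i < n → append n f u i ≡ shift u (f i)
append-old {n} {f} {u} {i} i<n with i <? n
... | yes _ = refl
... | no i≮n = ⊥-elim (i≮n i<n)

append-last : ∀ {n f u} → append n f u n ≡ u
append-last {n} {f} {u} with n <? n
... | yes n<n = ⊥-elim (<-irrefl refl n<n)
... | no _ = refl

data PositionView (n i : ℕ) : Set where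
  old : i < n → PositionView n i
  last : i ≡ n → PositionView n i

position-view : ∀ {n i} → i < suc n → PositionView n i
position-view i<1+n with m≤n⇒m<n∨m≡n (≤-pred i<1+n)
... | inj₁ i<n = old i<n
... | inj₂ i≡n = last i≡n

append-cong : ∀ {n f g u} → Agree n f g → Agree (suc n) (append n f u) (append n g u)
append-cong {n} {f} {g} {u} f≐g i i<1+n with position-view i<1+n
... | old i<n = trans (append-old {n} {f} i<n) (trans (cong (shift u) (f≐g i i<n)) (sym (append-old {n} {g} i<n)))
... | last refl = trans (append-last {n} {f}) (sym (append-last {n} {g}))

IsPerm-append : ∀ {n f u} → IsPerm n f → u ≤ n → IsPerm (suc n) (append n f u)
IsPerm-append {n} {f} {u} (bounded , injective) u≤n = bounded′ , injective′
  where
    bounded′ : ∀ i → i < suc n → append n f u i < suc n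
    bounded′ i i<1+n with position-view i<1+n
    ... | old i<n = subst (_< suc n) (sym (append-old {n} {f} i<n)) (shift<suc (bounded i i<n))
    ... | last refl = subst (_< suc n) (sym (append-last {n} {f})) (s≤s u≤n)
    injective′ : ∀ i j → i < suc n → j < suc n → append n f u i ≡ append n f u j → i ≡ j
    injective′ i j i<1+n j<1+n eq with position-view i<1+n | position-view j<1+n
    ... | old i<n | old j<n = injective i j i<n j<n
      (shift-injective (trans (sym (append-old {n} {f} i<n)) (trans eq (append-old {n} {f} j<n))))
    ... | old i<n | last refl = ⊥-elim (shift-≢ (trans (sym (append-old {n} {f} i<n)) (trans eq (append-last {n} {f}))))
    ... | last refl | old j<n = ⊥-elim (shift-≢ (trans (sym (append-old {n} {f} j<n)) (trans (sym eq) (append-last {n} {f}))))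
    ... | last refl | last refl = refl

removeLast : ℕ → (ℕ → ℕ) → ℕ → ℕ
removeLast n g i = unshift (g n) (g i)

module _ {n g} (π : IsPerm (suc n) g) where

  private
    bounded = proj₁ π
    injective = proj₂ π
    ≢last : ∀ {i} → i < n → g i ≢ g n
    ≢last i<n eq = <⇒≢ i<n (injective _ n (m<n⇒m<1+n i<n) (n<1+n n) eq)

  IsPerm-removeLast : IsPerm n (removeLast n g)
  IsPerm-removeLast = bounded′ , injective′
    where
      bounded′ : ∀ i → i < n → removeLast n g i < n
      bounded′ i i<n = unshift-< (≤-pred (bounded n (n<1+n n))) (bounded i (m<n⇒m<1+n i<n)) (≢last i<n)
      injective′ : ∀ i j → i < n → j < n → removeLast n g i ≡ removeLast n g j → i ≡ j
      injective′ i j i<n j<n eq = injective i j (m<n⇒m<1+n i<n) (m<n⇒m<1+n j<n)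
        (trans (sym (shift-unshift (≢last i<n))) (trans (cong (shift (g n)) eq) (shift-unshift (≢last j<n))))

  append-removeLast : Agree (suc n) g (append n (removeLast n g) (g n))
  append-removeLast i i<1+n with position-view i<1+n
  ... | old i<n = sym (trans (append-old {n} {removeLast n g} i<n) (shift-unshift (≢last i<n)))
  ... | last refl = sym (append-last {n} {removeLast n g})

-- Active sites

record Active (n : ℕ) (f : ℕ → ℕ) (u : ℕ) : Set where
  constructor active
  field
    no-descent-above : ∀ i j → i < j → j < n → f j < f i → u ≤ f j → ⊥
    no-ascent-from : ∀ i → suc i < n → f i ≡ u → f i < f (suc i) → ⊥
    no-3152-around : ∀ a b c d → a < b → b < c → c < d → d < n →
      f b < f d → f d < f a → f a < u → u ≤ f c → ⊥

data Blocked (n : ℕ) (f : ℕ → ℕ) (u : ℕ) : Set where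
  descent-above : ∀ i j → i < j → j < n → f j < f i → u ≤ f j → Blocked n f u
  ascent-from : ∀ i → suc i < n → f i ≡ u → f i < f (suc i) → Blocked n f u
  3152-around : ∀ a b c d → a < b → b < c → c < d → d < n →
    f b < f d → f d < f a → f a < u → u ≤ f c → Blocked n f u

Blocked⇒¬Active : ∀ {n f u} → Blocked n f u → Active n f u → ⊥
Blocked⇒¬Active (descent-above i j i<j j<n v w) act = Active.no-descent-above act i j i<j j<n v w
Blocked⇒¬Active (ascent-from i si<n eq up) act = Active.no-ascent-from act i si<n eq up
Blocked⇒¬Active (3152-around a b c d a<b b<c c<d d<n v₁ v₂ v₃ v₄) act =
  Active.no-3152-around act a b c d a<b b<c c<d d<n v₁ v₂ v₃ v₄

module Append {n : ℕ} {f : ℕ → ℕ} {u : ℕ} where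

  h : ℕ → ℕ
  h = append n f u

  h-last : h n ≡ u
  h-last = append-last {n} {f}

  h-old : ∀ {i} → i < n → h i ≡ shift u (f i)
  h-old = append-old {n} {f}

  h-mono : ∀ {i j} → i < n → j < n → f i < f j → h i < h j
  h-mono i<n j<n lt = subst₂ _<_ (sym (h-old i<n)) (sym (h-old j<n)) (shift-mono-< lt)

  h-cancel : ∀ {i j} → i < n → j < n → h i < h j → f i < f j
  h-cancel i<n j<n lt = shift-cancel-< (subst₂ _<_ (h-old i<n) (h-old j<n) lt)

  IsFishburn-append : IsFishburn n f → (∀ i → suc i < n → f i ≡ u → f i < f (suc i) → ⊥) →
    IsFishburn (suc n) h
  IsFishburn-append fish no-ascent i j i<j j<1+n si<1+n up eq with position-view j<1+n
  ... | old j<n = fish i j i<j j<n si<n (h-cancel i<n si<n up)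
    (shift-reflects-suc (trans (sym (h-old i<n)) (trans eq (cong suc (h-old j<n)))))
    where
      i<n = <-trans i<j j<n
      si<n = ≤-<-trans i<j j<n
  ... | last refl = from-view (shift-view u (f i))
    where
      hi≡1+u : shift u (f i) ≡ suc u
      hi≡1+u = trans (sym (h-old i<j)) (trans eq (cong suc h-last))
      from-view : ShiftView u (f i) → ⊥
      from-view (below fi<u ex) = <⇒≢ (m<n⇒m<1+n fi<u) (trans (sym ex) hi≡1+u)
      from-view (above _ ex) with position-view si<1+n
      ... | old si<n = no-ascent i si<n (suc-injective (trans (sym ex) hi≡1+u)) (h-cancel i<j si<n up)
      ... | last si≡n = <-asym (subst₂ _<_ (trans (h-old i<j) hi≡1+u) (trans (cong h si≡n) h-last) up) (n<1+n u)

  Avoids321-append : Avoids321 n f → (∀ i j → i < j → j < n → f j < f i → u ≤ f j → ⊥) →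
    Avoids321 (suc n) h
  Avoids321-append av no-descent i j k i<j j<k k<1+n v₁ v₂ with position-view k<1+n
  ... | old k<n = av i j k i<j j<k k<n (h-cancel j<n i<n v₁) (h-cancel k<n j<n v₂)
    where
      j<n = <-trans j<k k<n
      i<n = <-trans i<j j<n
  ... | last refl = no-descent i j i<j j<k (h-cancel j<k (<-trans i<j j<k) v₁)
    (shift>⇒≥ (subst₂ _<_ h-last (h-old j<k) v₂))

  Avoids31524-append : Avoids31524 n f →
    (∀ a b c d → a < b → b < c → c < d → d < n → f b < f d → f d < f a → f a < u → u ≤ f c → ⊥) →
    Avoids31524 (suc n) h
  Avoids31524-append av no-3152 a b c d e a<b b<c c<d d<e e<1+n v₁ v₂ v₃ v₄ with position-view e<1+n
  ... | old e<n = av a b c d e a<b b<c c<d d<e e<n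
    (h-cancel b<n d<n v₁) (h-cancel d<n a<n v₂) (h-cancel a<n e<n v₃) (h-cancel e<n c<n v₄)
    where
      d<n = <-trans d<e e<n
      c<n = <-trans c<d d<n
      b<n = <-trans b<c c<n
      a<n = <-trans a<b b<n
  ... | last refl = no-3152 a b c d a<b b<c c<d d<e (h-cancel b<n d<e v₁) (h-cancel d<e a<n v₂)
    (shift<⇒< (subst₂ _<_ (h-old a<n) h-last v₃)) (shift>⇒≥ (subst₂ _<_ h-last (h-old c<n) v₄))
    where
      c<n = <-trans c<d d<e
      b<n = <-trans b<c c<n
      a<n = <-trans a<b b<n

  InClass-append : InClass n f → Active n f u → InClass (suc n) h
  InClass-append (fish , av321 , av31524) (active no-descent no-ascent no-3152) =
    IsFishburn-append fish no-ascent , Avoids321-append av321 no-descent , Avoids31524-append av31524 no-3152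

  -- A Fishburn pattern of f whose two bottom values straddle u after shifting
  -- is f i = u, f j = u - 1, and then i with the new last entry is one for h.
  IsFishburn-init : IsFishburn (suc n) h → IsFishburn n f
  IsFishburn-init fish i j i<j j<n si<n up eq = from-views (shift-view u (f j)) (shift-view u (f i))
    where
      i<n = <-trans i<j j<n
      up′ = h-mono i<n si<n up
      via-j : shift u (f i) ≡ suc (shift u (f j)) → ⊥
      via-j e = fish i j i<j (m<n⇒m<1+n j<n) (m<n⇒m<1+n si<n) up′
        (trans (h-old i<n) (trans e (cong suc (sym (h-old j<n)))))
      from-views : ShiftView u (f j) → ShiftView u (f i) → ⊥
      from-views (below _ ej) (below _ ei) = via-j (trans ei (trans eq (cong suc (sym ej))))
      from-views (above _ ej) (above _ ei) = via-j (trans ei (trans (cong suc eq) (cong suc (sym ej))))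
      from-views (below fj<u _) (above u≤fi ei) = fish i n i<n (n<1+n n) (m<n⇒m<1+n si<n) up′
        (trans (h-old i<n) (trans ei (cong suc (trans fi≡u (sym h-last)))))
        where
          fi≡u : f i ≡ u
          fi≡u = ≤-antisym (subst (_≤ u) (sym eq) fj<u) u≤fi
      from-views (above u≤fj _) (below fi<u _) = <-asym fi<u (subst (u <_) (sym eq) (s≤s u≤fj))

  Active-of-InClass-append : InClass (suc n) h → Active n f u
  Active-of-InClass-append (fish , av321 , av31524) = active no-descent no-ascent no-3152
    where
      no-descent : ∀ i j → i < j → j < n → f j < f i → u ≤ f j → ⊥
      no-descent i j i<j j<n v w = av321 i j n i<j j<n (n<1+n n) (h-mono j<n (<-trans i<j j<n) v)
        (subst₂ _<_ (sym h-last) (sym (h-old j<n)) (subst (u <_) (sym (shift-≥ w)) (s≤s w)))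
      no-ascent : ∀ i → suc i < n → f i ≡ u → f i < f (suc i) → ⊥
      no-ascent i si<n fi≡u up = fish i n i<n (n<1+n n) (m<n⇒m<1+n si<n) (h-mono i<n si<n up)
        (trans (h-old i<n) (trans (cong (shift u) fi≡u) (trans (shift-≥ ≤-refl) (cong suc (sym h-last)))))
        where i<n = <-trans (n<1+n i) si<n
      no-3152 : ∀ a b c d → a < b → b < c → c < d → d < n →
        f b < f d → f d < f a → f a < u → u ≤ f c → ⊥
      no-3152 a b c d a<b b<c c<d d<n v₁ v₂ v₃ v₄ =
        av31524 a b c d n a<b b<c c<d d<n (n<1+n n) (h-mono b<n d<n v₁) (h-mono d<n a<n v₂)
          (subst₂ _<_ (sym (h-old a<n)) (sym h-last) (subst (_< u) (sym (shift-< v₃)) v₃))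
          (subst₂ _<_ (sym h-last) (sym (h-old c<n)) (subst (u <_) (sym (shift-≥ v₄)) (s≤s v₄)))
        where
          c<n = <-trans c<d d<n
          b<n = <-trans b<c c<n
          a<n = <-trans a<b b<n

  InClass-init : InClass (suc n) h → InClass n f
  InClass-init (fish , av321 , av31524) = IsFishburn-init fish , av321′ , av31524′
    where
      av321′ : Avoids321 n f
      av321′ i j k i<j j<k k<n v₁ v₂ = av321 i j k i<j j<k (m<n⇒m<1+n k<n) (h-mono j<n i<n v₁) (h-mono k<n j<n v₂)
        where
          j<n = <-trans j<k k<n
          i<n = <-trans i<j j<n
      av31524′ : Avoids31524 n f
      av31524′ a b c d e a<b b<c c<d d<e e<n v₁ v₂ v₃ v₄ =
        av31524 a b c d e a<b b<c c<d d<e (m<n⇒m<1+n e<n)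
          (h-mono b<n d<n v₁) (h-mono d<n a<n v₂) (h-mono a<n e<n v₃) (h-mono e<n c<n v₄)
        where
          d<n = <-trans d<e e<n
          c<n = <-trans c<d d<n
          b<n = <-trans b<c c<n
          a<n = <-trans a<b b<n

  Active-append-suc : Active n f u → Active (suc n) h (suc u)
  Active-append-suc (active no-descent no-ascent no-3152) = active no-descent′ no-ascent′ no-3152′
    where
      no-descent′ : ∀ i j → i < j → j < suc n → h j < h i → suc u ≤ h j → ⊥
      no-descent′ i j i<j j<1+n v w with position-view j<1+n
      ... | old j<n = no-descent i j i<j j<n (h-cancel j<n (<-trans i<j j<n) v)
        (shift>⇒≥ (≤-trans w (≤-reflexive (h-old j<n))))
      ... | last refl = <⇒≱ (n<1+n u) (subst (suc u ≤_) h-last w)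
      no-ascent′ : ∀ i → suc i < suc n → h i ≡ suc u → h i < h (suc i) → ⊥
      no-ascent′ i si<1+n eq up with position-view si<1+n
      ... | old si<n = no-ascent i si<n (shift≡suc⇒≡ (trans (sym (h-old i<n)) eq)) (h-cancel i<n si<n up)
        where i<n = <-trans (n<1+n i) si<n
      ... | last si≡n = <-asym (n<1+n u) (subst₂ _<_ eq (trans (cong h si≡n) h-last) up)
      no-3152′ : ∀ a b c d → a < b → b < c → c < d → d < suc n →
        h b < h d → h d < h a → h a < suc u → suc u ≤ h c → ⊥
      no-3152′ a b c d a<b b<c c<d d<1+n v₁ v₂ v₃ v₄ with position-view d<1+n
      ... | old d<n = no-3152 a b c d a<b b<c c<d d<n (h-cancel b<n d<n v₁) (h-cancel d<n a<n v₂)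
          (shift≤⇒< (subst (_≤ u) (h-old a<n) (≤-pred v₃))) (shift>⇒≥ (≤-trans v₄ (≤-reflexive (h-old c<n))))
        where
          c<n = <-trans c<d d<n
          b<n = <-trans b<c c<n
          a<n = <-trans a<b b<n
      ... | last refl = <⇒≱ (subst (_< h a) h-last v₂) (≤-pred v₃)

  Blocked-append-below : ∀ {w} → Blocked n f w → w < u → Blocked (suc n) h w
  Blocked-append-below (descent-above i j i<j j<n v w≤fj) w<u =
    descent-above i j i<j (m<n⇒m<1+n j<n) (h-mono j<n (<-trans i<j j<n) v)
      (≤-trans w≤fj (≤-trans x≤shift (≤-reflexive (sym (h-old j<n)))))
  Blocked-append-below (ascent-from i si<n eq up) w<u =
    ascent-from i (m<n⇒m<1+n si<n) (trans (h-old i<n) (trans (shift-< (subst (_< u) (sym eq) w<u)) eq))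
      (h-mono i<n si<n up)
    where i<n = <-trans (n<1+n i) si<n
  Blocked-append-below (3152-around a b c d a<b b<c c<d d<n v₁ v₂ v₃ v₄) w<u =
    3152-around a b c d a<b b<c c<d (m<n⇒m<1+n d<n) (h-mono b<n d<n v₁) (h-mono d<n a<n v₂)
      (subst (_< _) (sym (trans (h-old a<n) (shift-< (<-trans v₃ w<u)))) v₃)
      (≤-trans v₄ (≤-trans x≤shift (≤-reflexive (sym (h-old c<n)))))
    where
      c<n = <-trans c<d d<n
      b<n = <-trans b<c c<n
      a<n = <-trans a<b b<n

  Blocked-append-above : ∀ {w} → Blocked n f w → u ≤ w → Blocked (suc n) h (suc w)
  Blocked-append-above (descent-above i j i<j j<n v w≤fj) u≤w =
    descent-above i j i<j (m<n⇒m<1+n j<n) (h-mono j<n (<-trans i<j j<n) v)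
      (subst (suc _ ≤_) (sym (trans (h-old j<n) (shift-≥ (≤-trans u≤w w≤fj)))) (s≤s w≤fj))
  Blocked-append-above (ascent-from i si<n eq up) u≤w =
    ascent-from i (m<n⇒m<1+n si<n) (trans (h-old i<n) (trans (shift-≥ (subst (u ≤_) (sym eq) u≤w)) (cong suc eq)))
      (h-mono i<n si<n up)
    where i<n = <-trans (n<1+n i) si<n
  Blocked-append-above (3152-around a b c d a<b b<c c<d d<n v₁ v₂ v₃ v₄) u≤w =
    3152-around a b c d a<b b<c c<d (m<n⇒m<1+n d<n) (h-mono b<n d<n v₁) (h-mono d<n a<n v₂)
      (subst (_< suc _) (sym (h-old a<n)) (≤-<-trans shift≤suc (s≤s v₃)))
      (subst (suc _ ≤_) (sym (trans (h-old c<n) (shift-≥ (≤-trans u≤w v₄)))) (s≤s v₄))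
    where
      c<n = <-trans c<d d<n
      b<n = <-trans b<c c<n
      a<n = <-trans a<b b<n

Active-top : ∀ {n f} → IsPerm n f → Active n f n
Active-top {n} {f} (bounded , _) = active
  (λ i j i<j j<n _ n≤fj → <⇒≱ (bounded j j<n) n≤fj)
  (λ i si<n fi≡n _ → <⇒≢ (bounded i (<-trans (n<1+n i) si<n)) fi≡n)
  (λ a b c d _ _ c<d d<n _ _ _ n≤fc → <⇒≱ (bounded c (<-trans c<d d<n)) n≤fc)

Active-last-max : ∀ {k f} → IsPerm (suc k) f → f k ≡ k → Active (suc k) f k
Active-last-max {k} {f} (bounded , injective) fk≡k = active
  (λ i j i<j j<n v k≤fj → <⇒≱ v (≤-trans (≤-pred (bounded i (<-trans i<j j<n))) k≤fj))
  (λ i si<n fi≡k up → <⇒≱ (bounded (suc i) si<n) (subst (_< f (suc i)) fi≡k up))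
  no-3152
  where
    no-3152 : ∀ a b c d → a < b → b < c → c < d → d < suc k →
      f b < f d → f d < f a → f a < k → k ≤ f c → ⊥
    no-3152 a b c d _ _ c<d d<n _ _ _ k≤fc =
      <⇒≢ (<-≤-trans c<d (≤-pred d<n)) (injective c k c<n (n<1+n k) (trans fc≡k (sym fk≡k)))
      where
        c<n = <-trans c<d d<n
        fc≡k : f c ≡ k
        fc≡k = ≤-antisym (≤-pred (bounded c c<n)) k≤fc

append-top-old : ∀ {n f i} → IsPerm n f → i < n → append n f n i ≡ f i
append-top-old {n} {f} (bounded , _) i<n = trans (append-old {n} {f} i<n) (shift-< (bounded _ i<n))

Active-append-top : ∀ {k f t} → IsPerm (suc k) f → Active (suc k) f t → f k ≢ t →
  Active (suc (suc k)) (append (suc k) f (suc k)) t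
Active-append-top {k} {f} {t} π@(bounded , _) (active no-descent no-ascent no-3152) fk≢t =
  active no-descent′ no-ascent′ no-3152′
  where
    h = append (suc k) f (suc k)
    h-old : ∀ {i} → i < suc k → h i ≡ f i
    h-old = append-top-old π
    h-last : h (suc k) ≡ suc k
    h-last = append-last {suc k} {f}
    no-descent′ : ∀ i j → i < j → j < suc (suc k) → h j < h i → t ≤ h j → ⊥
    no-descent′ i j i<j j<n v w with position-view j<n
    ... | old j<k = no-descent i j i<j j<k (subst₂ _<_ (h-old j<k) (h-old (<-trans i<j j<k)) v) (subst (t ≤_) (h-old j<k) w)
    ... | last refl = <⇒≱ (subst₂ _<_ h-last (h-old i<j) v) (<⇒≤ (bounded i i<j))
    no-ascent′ : ∀ i → suc i < suc (suc k) → h i ≡ t → h i < h (suc i) → ⊥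
    no-ascent′ i si<n eq up with position-view si<n
    ... | old si<k = no-ascent i si<k (trans (sym (h-old i<k)) eq) (subst₂ _<_ (h-old i<k) (h-old si<k) up)
      where i<k = <-trans (n<1+n i) si<k
    ... | last refl = fk≢t (trans (sym (h-old (n<1+n i))) eq)
    no-3152′ : ∀ a b c d → a < b → b < c → c < d → d < suc (suc k) →
      h b < h d → h d < h a → h a < t → t ≤ h c → ⊥
    no-3152′ a b c d a<b b<c c<d d<n v₁ v₂ v₃ v₄ with position-view d<n
    ... | old d<k = no-3152 a b c d a<b b<c c<d d<k (subst₂ _<_ (h-old b<k) (h-old d<k) v₁)
        (subst₂ _<_ (h-old d<k) (h-old a<k) v₂) (subst (_< t) (h-old a<k) v₃) (subst (t ≤_) (h-old c<k) v₄)
      where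
        c<k = <-trans c<d d<k
        b<k = <-trans b<c c<k
        a<k = <-trans a<b b<k
    ... | last refl = <-asym (subst₂ _<_ h-last (h-old a<k) v₂) (bounded a a<k)
      where a<k = <-trans a<b (<-trans b<c c<d)

-- The generating tree

DescentTop : ℕ → (ℕ → ℕ) → ℕ → Set
DescentTop n f t = Σ ℕ λ p → (suc p < n) × (f p ≡ t) × (f (suc p) < t)

data Sites (k : ℕ) (f : ℕ → ℕ) : Set where
  identity : (∀ i → i < suc k → f i ≡ i) → Sites k f
  two : (t : ℕ) → Active (suc k) f t → DescentTop (suc k) f t →
    (∀ v → v ≤ suc k → v ≢ t → v ≢ suc k → Blocked (suc k) f v) → Sites k f
  three : (t : ℕ) → Active (suc k) f t → DescentTop (suc k) f t → f k ≡ k →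
    (∀ v → v ≤ suc k → v ≢ t → v ≢ k → v ≢ suc k → Blocked (suc k) f v) → Sites k f

record Node (k : ℕ) : Set where
  constructor node
  field
    fun : ℕ → ℕ
    isPerm : IsPerm (suc k) fun
    inClass : InClass (suc k) fun
    sites : Sites k fun

open Node

≤suc∧≢suc⇒≤ : ∀ {v m} → v ≤ suc m → v ≢ suc m → v ≤ m
≤suc∧≢suc⇒≤ v≤1+m v≢1+m = ≤-pred (≤∧≢⇒< v≤1+m v≢1+m)

DescentTop-≤ : ∀ {k f t} → IsPerm (suc k) f → DescentTop (suc k) f t → t ≤ k
DescentTop-≤ (bounded , _) (p , sp<n , fp≡t , _) = ≤-pred (subst (_< _) fp≡t (bounded p (<-trans (n<1+n p) sp<n)))

DescentTop-not-last : ∀ {k f t} → IsPerm (suc k) f → DescentTop (suc k) f t → f k ≢ t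
DescentTop-not-last {k} (_ , injective) (p , sp<n , fp≡t , _) fk≡t =
  <⇒≢ (≤-pred sp<n) (sym (injective k p (n<1+n k) (<-trans (n<1+n p) sp<n) (trans fk≡t (sym fp≡t))))

childTop : ∀ {k} → Node k → Node (suc k)
childTop {k} (node f π cls s) =
  node h (IsPerm-append π ≤-refl) (Append.InClass-append cls (Active-top π)) (sites′ s)
  where
    h = append (suc k) f (suc k)
    h-old : ∀ {i} → i < suc k → h i ≡ f i
    h-old = append-top-old π
    h-last : h (suc k) ≡ suc k
    h-last = append-last {suc k} {f}
    descentTop′ : ∀ {t} → DescentTop (suc k) f t → DescentTop (suc (suc k)) h t
    descentTop′ (p , sp<n , fp≡t , fsp<t) =
      p , m<n⇒m<1+n sp<n , trans (h-old (<-trans (n<1+n p) sp<n)) fp≡t , subst (_< _) (sym (h-old sp<n)) fsp<t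
    identity′ : (∀ i → i < suc k → f i ≡ i) → ∀ i → i < suc (suc k) → h i ≡ i
    identity′ f≡id i i<n with position-view i<n
    ... | old i<k = trans (h-old i<k) (f≡id i i<k)
    ... | last refl = h-last
    sites′ : Sites k f → Sites (suc k) h
    sites′ (identity f≡id) = identity (identity′ f≡id)
    sites′ (two t act top blocked) =
      three t (Active-append-top π act (DescentTop-not-last π top)) (descentTop′ top) h-last blocked′
      where
        blocked′ : ∀ v → v ≤ suc (suc k) → v ≢ t → v ≢ suc k → v ≢ suc (suc k) → Blocked (suc (suc k)) h v
        blocked′ v v≤ v≢t v≢k v≢n = Append.Blocked-append-below (blocked v (m≤n⇒m≤1+n v≤k) v≢t (<⇒≢ (s≤s v≤k))) (s≤s v≤k)
          where v≤k = ≤suc∧≢suc⇒≤ (≤suc∧≢suc⇒≤ v≤ v≢n) v≢k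
    sites′ (three t act top fk≡k blocked) =
      three t (Active-append-top π act (DescentTop-not-last π top)) (descentTop′ top) h-last blocked′
      where
        blocked′ : ∀ v → v ≤ suc (suc k) → v ≢ t → v ≢ suc k → v ≢ suc (suc k) → Blocked (suc (suc k)) h v
        blocked′ v v≤ v≢t v≢k v≢n with v ≟ k
        ... | yes refl = ascent-from k ≤-refl (trans (h-old (n<1+n k)) fk≡k)
          (subst₂ _<_ (sym (trans (h-old (n<1+n k)) fk≡k)) (sym h-last) (n<1+n k))
        ... | no v≢k′ = Append.Blocked-append-below (blocked v (m≤n⇒m≤1+n v≤k) v≢t v≢k′ (<⇒≢ (s≤s v≤k))) (s≤s v≤k)
          where v≤k = ≤suc∧≢suc⇒≤ (≤suc∧≢suc⇒≤ v≤ v≢n) v≢k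

childBelowLast : ∀ {k} (N : Node k) → fun N k ≡ k → Node (suc k)
childBelowLast {k} (node f π cls _) fk≡k =
  node h (IsPerm-append π (n≤1+n k)) (Append.InClass-append cls active-k)
    (two (suc k) (Append.Active-append-suc active-k) top blocked)
  where
    active-k = Active-last-max π fk≡k
    h = append (suc k) f k
    h-k : h k ≡ suc k
    h-k = trans (append-old {suc k} {f} (n<1+n k)) (trans (cong (shift k) fk≡k) (shift-≥ ≤-refl))
    h-last : h (suc k) ≡ k
    h-last = append-last {suc k} {f}
    top : DescentTop (suc (suc k)) h (suc k)
    top = k , ≤-refl , h-k , subst (_< suc k) (sym h-last) (n<1+n k)
    blocked : ∀ v → v ≤ suc (suc k) → v ≢ suc k → v ≢ suc (suc k) → Blocked (suc (suc k)) h v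
    blocked v v≤ v≢k v≢n = descent-above k (suc k) (n<1+n k) (n<1+n (suc k))
      (subst₂ _<_ (sym h-last) (sym h-k) (n<1+n k)) (subst (v ≤_) (sym h-last) (≤suc∧≢suc⇒≤ (≤suc∧≢suc⇒≤ v≤ v≢n) v≢k))

childDescent : ∀ {k} (N : Node k) (t : ℕ) → Active (suc k) (fun N) t → DescentTop (suc k) (fun N) t →
  (∀ w → t < w → w ≤ k → Blocked (suc (suc k)) (append (suc k) (fun N) t) (suc w)) → Node (suc k)
childDescent {k} (node f π cls _) t act top@(p , sp<n , fp≡t , fsp<t) blocked-above =
  node h (IsPerm-append π (m≤n⇒m≤1+n (DescentTop-≤ π top))) (Append.InClass-append cls act)
    (two (suc t) (Append.Active-append-suc act) top′ blocked)
  where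
    h = append (suc k) f t
    p<n = <-trans (n<1+n p) sp<n
    h-p : h p ≡ suc t
    h-p = trans (append-old {suc k} {f} p<n) (trans (cong (shift t) fp≡t) (shift-≥ ≤-refl))
    h-last : h (suc k) ≡ t
    h-last = append-last {suc k} {f}
    top′ : DescentTop (suc (suc k)) h (suc t)
    top′ = p , m<n⇒m<1+n sp<n , h-p ,
      subst (_< suc t) (sym (trans (append-old {suc k} {f} sp<n) (shift-< fsp<t))) (m<n⇒m<1+n fsp<t)
    blocked : ∀ v → v ≤ suc (suc k) → v ≢ suc t → v ≢ suc (suc k) → Blocked (suc (suc k)) h v
    blocked v v≤ v≢t v≢n with v ≤? t
    ... | yes v≤t = descent-above p (suc k) p<n (n<1+n (suc k))
      (subst₂ _<_ (sym h-last) (sym h-p) (n<1+n t)) (subst (v ≤_) (sym h-last) v≤t)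
    blocked zero v≤ v≢t v≢n | no v≰t = ⊥-elim (v≰t z≤n)
    blocked (suc w) v≤ v≢t v≢n | no v≰t = blocked-above w t<w (≤-pred (≤suc∧≢suc⇒≤ v≤ v≢n))
      where t<w = ≤∧≢⇒< (≤-pred (≰⇒> v≰t)) (λ t≡w → v≢t (cong suc (sym t≡w)))

module _ {k : ℕ} (N : Node k) (t : ℕ) where

  private
    f = fun N
    h = append (suc k) f t

  blocked-above-two : (∀ v → v ≤ suc k → v ≢ t → v ≢ suc k → Blocked (suc k) f v) →
    ∀ w → t < w → w ≤ k → Blocked (suc (suc k)) h (suc w)
  blocked-above-two blocked w t<w w≤k =
    Append.Blocked-append-above (blocked w (m≤n⇒m≤1+n w≤k) (λ w≡t → <⇒≢ t<w (sym w≡t)) (<⇒≢ (s≤s w≤k))) (<⇒≤ t<w)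

  -- For w = k, the entries at positions p, p + 1, k and the new last one form a 3152 around k + 1.
  blocked-above-three : DescentTop (suc k) f t → f k ≡ k →
    (∀ v → v ≤ suc k → v ≢ t → v ≢ k → v ≢ suc k → Blocked (suc k) f v) →
    ∀ w → t < w → w ≤ k → Blocked (suc (suc k)) h (suc w)
  blocked-above-three top@(p , sp<n , fp≡t , fsp<t) fk≡k blocked w t<w w≤k with w ≟ k
  ... | no w≢k = Append.Blocked-append-above
    (blocked w (m≤n⇒m≤1+n w≤k) (λ w≡t → <⇒≢ t<w (sym w≡t)) w≢k (<⇒≢ (s≤s w≤k))) (<⇒≤ t<w)
  ... | yes refl = 3152-around p (suc p) k (suc k) (n<1+n p) sp<k (n<1+n k) (n<1+n (suc k))
    (subst₂ _<_ (sym h-sp) (sym h-last) fsp<t)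
    (subst₂ _<_ (sym h-last) (sym h-p) (n<1+n t))
    (subst (_< suc k) (sym h-p) (s≤s t<w))
    (≤-reflexive (sym h-k))
    where
      π = isPerm N
      sp<k : suc p < k
      sp<k = ≤∧≢⇒< (≤-pred sp<n)
        (λ sp≡k → <⇒≱ fsp<t (≤-trans (DescentTop-≤ π top) (≤-reflexive (sym (trans (cong f sp≡k) fk≡k)))))
      h-sp : h (suc p) ≡ f (suc p)
      h-sp = trans (append-old {suc k} {f} sp<n) (shift-< fsp<t)
      h-p : h p ≡ suc t
      h-p = trans (append-old {suc k} {f} (<-trans (n<1+n p) sp<n)) (trans (cong (shift t) fp≡t) (shift-≥ ≤-refl))
      h-last : h (suc k) ≡ t
      h-last = append-last {suc k} {f}
      h-k : h k ≡ suc k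
      h-k = trans (append-old {suc k} {f} (n<1+n k)) (trans (cong (shift t) fk≡k) (shift-≥ (<⇒≤ t<w)))

children : ∀ {k} → Node k → List (Node (suc k))
children N@(node _ _ _ (identity f≡id)) = childTop N ∷ childBelowLast N (f≡id _ (n<1+n _)) ∷ []
children N@(node _ _ _ (two t act top blocked)) =
  childTop N ∷ childDescent N t act top (blocked-above-two N t blocked) ∷ []
children N@(node _ _ _ (three t act top fk≡k blocked)) =
  childTop N ∷ childBelowLast N fk≡k ∷ childDescent N t act top (blocked-above-three N t top fk≡k blocked) ∷ []

root : Node 0
root = node (λ _ → 0) ((λ _ _ → s≤s z≤n) , injective) inClass₁ (identity λ { zero _ → refl ; (suc i) (s≤s ()) })
  where
    injective : ∀ i j → i < 1 → j < 1 → 0 ≡ 0 → i ≡ j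
    injective zero zero _ _ _ = refl
    injective zero (suc j) _ (s≤s ()) _
    injective (suc i) _ (s≤s ()) _ _
    inClass₁ : InClass 1 (λ _ → 0)
    inClass₁ = (λ _ _ _ _ si<1 → ⊥-elim (<⇒≱ si<1 (s≤s z≤n)))
      , (λ _ _ _ _ j<k k<1 → ⊥-elim (<⇒≱ (<-≤-trans j<k (≤-pred k<1)) z≤n))
      , (λ _ _ _ _ _ _ _ _ d<e e<1 → ⊥-elim (<⇒≱ (<-≤-trans d<e (≤-pred e<1)) z≤n))

nodes : ∀ k → List (Node k)
nodes zero = root ∷ []
nodes (suc k) = concatMap children (nodes k)

Extends : ℕ → (ℕ → ℕ) → ℕ → (ℕ → ℕ) → Set
Extends k f u g = Agree (suc (suc k)) g (append (suc k) f u)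

extends-≡ : ∀ {k f u u′} → u′ ≡ u → Extends k f u (append (suc k) f u′)
extends-≡ refl _ _ = refl

child-at-active : ∀ {k} (N : Node k) u → u ≤ suc k → Active (suc k) (fun N) u →
  Any (λ c → Extends k (fun N) u (fun c)) (children N)
child-at-active {k} (node f _ _ (identity f≡id)) u u≤ act with u ≟ suc k | u ≟ k
... | yes u≡ | _ = here (extends-≡ (sym u≡))
... | no _ | yes u≡ = there (here (extends-≡ (sym u≡)))
... | no u≢n | no u≢k = ⊥-elim (Blocked⇒¬Active (ascent-from u (s≤s u<k) (f≡id u (m<n⇒m<1+n u<k))
    (subst₂ _<_ (sym (f≡id u (m<n⇒m<1+n u<k))) (sym (f≡id (suc u) (s≤s u<k))) (n<1+n u))) act)
  where u<k = ≤∧≢⇒< (≤suc∧≢suc⇒≤ u≤ u≢n) u≢k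
child-at-active {k} (node _ _ _ (two t _ _ blocked)) u u≤ act with u ≟ suc k | u ≟ t
... | yes u≡ | _ = here (extends-≡ (sym u≡))
... | no _ | yes u≡ = there (here (extends-≡ (sym u≡)))
... | no u≢n | no u≢t = ⊥-elim (Blocked⇒¬Active (blocked u u≤ u≢t u≢n) act)
child-at-active {k} (node _ _ _ (three t _ _ _ blocked)) u u≤ act with u ≟ suc k | u ≟ k | u ≟ t
... | yes u≡ | _ | _ = here (extends-≡ (sym u≡))
... | no _ | yes u≡ | _ = there (here (extends-≡ (sym u≡)))
... | no _ | no _ | yes u≡ = there (there (here (extends-≡ (sym u≡))))
... | no u≢n | no u≢k | no u≢t = ⊥-elim (Blocked⇒¬Active (blocked u u≤ u≢t u≢k u≢n) act)

nodes-complete : ∀ k g → IsPerm (suc k) g → InClass (suc k) g → Any (λ N → Agree (suc k) (fun N) g) (nodes k)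
nodes-complete zero g (bounded , _) _ =
  here λ { zero _ → sym (n≤0⇒n≡0 (≤-pred (bounded 0 (s≤s z≤n)))) ; (suc i) (s≤s ()) }
nodes-complete (suc k) g π cls =
  Any.concatMap⁺ children (Any.map from-parent (nodes-complete k f (IsPerm-removeLast π) cls-f))
  where
    f = removeLast (suc k) g
    u = g (suc k)
    g≐f+u : Agree (suc (suc k)) g (append (suc k) f u)
    g≐f+u = append-removeLast π
    cls-f : InClass (suc k) f
    cls-f = Append.InClass-init (InClass-cong g≐f+u cls)
    from-parent : ∀ {N} → Agree (suc k) (fun N) f → Any (λ c → Agree (suc (suc k)) (fun c) g) (children N)
    from-parent {N} N≐f = Any.map (λ c≐ → Agree-trans c≐ (Agree-sym g≐N+u))
      (child-at-active N u (≤-pred (proj₁ π (suc k) (n<1+n _))) (Append.Active-of-InClass-append (InClass-cong g≐N+u cls)))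
      where
        g≐N+u : Agree (suc (suc k)) g (append (suc k) (fun N) u)
        g≐N+u = Agree-trans g≐f+u (append-cong (Agree-sym N≐f))

Distinct : ∀ {k} → Node k → Node k → Set
Distinct {k} N N′ = ¬ Agree (suc k) (fun N) (fun N′)

distinct-last : ∀ {k f f′ u u′} → u ≢ u′ → ¬ Agree (suc (suc k)) (append (suc k) f u) (append (suc k) f′ u′)
distinct-last {k} {f} {f′} u≢u′ eq =
  u≢u′ (trans (sym (append-last {suc k} {f})) (trans (eq (suc k) (n<1+n _)) (append-last {suc k} {f′})))

-- The last entries of two extensions determine the two shifts, which are then cancelled.
Agree-parents : ∀ {k f f′ u u′ g g′} → Extends k f u g → Extends k f′ u′ g′ →
  Agree (suc (suc k)) g g′ → Agree (suc k) f f′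
Agree-parents {k} {f} {f′} {u} {u′} g≐ g′≐ g≐g′ i i<n = shift-injective
  (trans (sym (append-old {suc k} {f} i<n))
  (trans (sym (g≐ i i<1+n)) (trans (g≐g′ i i<1+n) (trans (g′≐ i i<1+n)
  (trans (append-old {suc k} {f′} i<n) (cong (λ x → shift x (f′ i)) (sym u≡u′)))))))
  where
    i<1+n = m<n⇒m<1+n i<n
    k+1<k+2 = n<1+n (suc k)
    u≡u′ : u ≡ u′
    u≡u′ = trans (sym (append-last {suc k} {f})) (trans (sym (g≐ (suc k) k+1<k+2))
      (trans (g≐g′ (suc k) k+1<k+2) (trans (g′≐ (suc k) k+1<k+2) (append-last {suc k} {f′}))))

children-extend : ∀ {k} (N : Node k) → All (λ c → Σ ℕ λ u → Extends k (fun N) u (fun c)) (children N)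
children-extend (node _ _ _ (identity _)) = (_ , λ _ _ → refl) ∷ (_ , λ _ _ → refl) ∷ []
children-extend (node _ _ _ (two _ _ _ _)) = (_ , λ _ _ → refl) ∷ (_ , λ _ _ → refl) ∷ []
children-extend (node _ _ _ (three _ _ _ _ _)) = (_ , λ _ _ → refl) ∷ (_ , λ _ _ → refl) ∷ (_ , λ _ _ → refl) ∷ []

children-distinct : ∀ {k} (N : Node k) → AllPairs Distinct (children N)
children-distinct {k} (node _ _ _ (identity _)) = (distinct-last (λ e → <⇒≢ (n<1+n k) (sym e)) ∷ []) ∷ [] ∷ []
children-distinct {k} (node _ π _ (two t _ top _)) =
  (distinct-last (λ e → <⇒≢ (s≤s (DescentTop-≤ π top)) (sym e)) ∷ []) ∷ [] ∷ []
children-distinct {k} (node _ π _ (three t _ top fk≡k _)) =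
  (distinct-last (λ e → <⇒≢ (n<1+n k) (sym e)) ∷ distinct-last (λ e → <⇒≢ (s≤s (DescentTop-≤ π top)) (sym e)) ∷ [])
  ∷ (distinct-last (λ e → DescentTop-not-last π top (trans fk≡k e)) ∷ []) ∷ [] ∷ []

nodes-distinct : ∀ k → AllPairs Distinct (nodes k)
nodes-distinct zero = [] ∷ []
nodes-distinct (suc k) = AllPairs.concat⁺ (All.map⁺ (All.universal children-distinct (nodes k)))
  (AllPairs.map⁺ (AllPairs.map cousins-distinct (nodes-distinct k)))
  where
    cousins-distinct : ∀ {N N′} → Distinct N N′ → All (λ c → All (Distinct c) (children N′)) (children N)
    cousins-distinct {N} {N′} N≠N′ = All.map
      (λ (_ , c≐) → All.map (λ (_ , c′≐) c≐c′ → N≠N′ (Agree-parents c≐ c′≐ c≐c′)) (children-extend N′))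
      (children-extend N)

-- Counting

record Tally : Set where
  constructor ⟨_,_,_⟩
  field
    identities twos threes : ℕ

_⊕_ : Tally → Tally → Tally
⟨ a , b , c ⟩ ⊕ ⟨ a′ , b′ , c′ ⟩ = ⟨ a + a′ , b + b′ , c + c′ ⟩

total : Tally → ℕ
total ⟨ a , b , c ⟩ = a + b + c

tallyOf : ∀ {k} → Node k → Tally
tallyOf (node _ _ _ (identity _)) = ⟨ 1 , 0 , 0 ⟩
tallyOf (node _ _ _ (two _ _ _ _)) = ⟨ 0 , 1 , 0 ⟩
tallyOf (node _ _ _ (three _ _ _ _ _)) = ⟨ 0 , 0 , 1 ⟩

tally : ∀ {k} → List (Node k) → Tally
tally [] = ⟨ 0 , 0 , 0 ⟩
tally (N ∷ Ns) = tallyOf N ⊕ tally Ns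

step : Tally → Tally
step ⟨ a , b , c ⟩ = ⟨ a , a + b + 2 * c , b + c ⟩

⟨⟩-cong : ∀ {a a′ b b′ c c′} → a ≡ a′ → b ≡ b′ → c ≡ c′ → ⟨ a , b , c ⟩ ≡ ⟨ a′ , b′ , c′ ⟩
⟨⟩-cong refl refl refl = refl

⊕-assoc : ∀ x y z → (x ⊕ y) ⊕ z ≡ x ⊕ (y ⊕ z)
⊕-assoc ⟨ a , b , c ⟩ ⟨ a′ , b′ , c′ ⟩ ⟨ a″ , b″ , c″ ⟩ =
  ⟨⟩-cong (+-assoc a a′ a″) (+-assoc b b′ b″) (+-assoc c c′ c″)

step-⊕ : ∀ x y → step (x ⊕ y) ≡ step x ⊕ step y
step-⊕ ⟨ a , b , c ⟩ ⟨ a′ , b′ , c′ ⟩ = ⟨⟩-cong refl (twos a b c a′ b′ c′) (threes b c b′ c′)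
  where
    twos : ∀ a b c a′ b′ c′ → a + a′ + (b + b′) + 2 * (c + c′) ≡ a + b + 2 * c + (a′ + b′ + 2 * c′)
    twos = solve-∀
    threes : ∀ b c b′ c′ → b + b′ + (c + c′) ≡ b + c + (b′ + c′)
    threes = solve-∀

tally-++ : ∀ {k} (xs ys : List (Node k)) → tally (xs ++ ys) ≡ tally xs ⊕ tally ys
tally-++ [] ys = refl
tally-++ (x ∷ xs) ys = trans (cong (tallyOf x ⊕_) (tally-++ xs ys)) (sym (⊕-assoc (tallyOf x) (tally xs) (tally ys)))

tally-children : ∀ {k} (N : Node k) → tally (children N) ≡ step (tallyOf N)
tally-children (node _ _ _ (identity _)) = refl
tally-children (node _ _ _ (two _ _ _ _)) = refl
tally-children (node _ _ _ (three _ _ _ _ _)) = refl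

tally-concatMap-children : ∀ {k} (Ns : List (Node k)) → tally (concatMap children Ns) ≡ step (tally Ns)
tally-concatMap-children [] = refl
tally-concatMap-children (N ∷ Ns) = begin
  tally (children N ++ concatMap children Ns)        ≡⟨ tally-++ (children N) (concatMap children Ns) ⟩
  tally (children N) ⊕ tally (concatMap children Ns) ≡⟨ cong₂ _⊕_ (tally-children N) (tally-concatMap-children Ns) ⟩
  step (tallyOf N) ⊕ step (tally Ns)                 ≡⟨ sym (step-⊕ (tallyOf N) (tally Ns)) ⟩
  step (tallyOf N ⊕ tally Ns)                        ∎
  where open ≡-Reasoning

total-⊕ : ∀ x y → total (x ⊕ y) ≡ total x + total y
total-⊕ ⟨ a , b , c ⟩ ⟨ a′ , b′ , c′ ⟩ = rearrange a b c a′ b′ c′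
  where
    rearrange : ∀ a b c a′ b′ c′ → a + a′ + (b + b′) + (c + c′) ≡ a + b + c + (a′ + b′ + c′)
    rearrange = solve-∀

total-tallyOf : ∀ {k} (N : Node k) → total (tallyOf N) ≡ 1
total-tallyOf (node _ _ _ (identity _)) = refl
total-tallyOf (node _ _ _ (two _ _ _ _)) = refl
total-tallyOf (node _ _ _ (three _ _ _ _ _)) = refl

length≡total-tally : ∀ {k} (Ns : List (Node k)) → length Ns ≡ total (tally Ns)
length≡total-tally [] = refl
length≡total-tally (N ∷ Ns) = sym (begin
  total (tallyOf N ⊕ tally Ns)      ≡⟨ total-⊕ (tallyOf N) (tally Ns) ⟩
  total (tallyOf N) + total (tally Ns) ≡⟨ cong₂ _+_ (total-tallyOf N) (sym (length≡total-tally Ns)) ⟩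
  suc (length Ns)                   ∎)
  where open ≡-Reasoning

pellSum : ℕ → ℕ
pellSum zero = 0
pellSum (suc k) = pell k + pellSum k

pell-suc : ∀ k → pell (suc k) ≡ pell k + 2 * pellSum k + 1
pell-suc zero = refl
pell-suc (suc k) = begin
  2 * pell (suc k) + p                 ≡⟨ cong (λ q → 2 * q + p) (pell-suc k) ⟩
  2 * (p + 2 * s + 1) + p              ≡⟨ rearrange p s ⟩
  (p + 2 * s + 1) + 2 * (p + s) + 1    ≡⟨ cong (λ q → q + 2 * (p + s) + 1) (sym (pell-suc k)) ⟩
  pell (suc k) + 2 * (p + s) + 1       ∎
  where
    open ≡-Reasoning
    p = pell k
    s = pellSum k
    rearrange : ∀ p s → 2 * (p + 2 * s + 1) + p ≡ (p + 2 * s + 1) + 2 * (p + s) + 1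
    rearrange = solve-∀

tally-nodes : ∀ k → tally (nodes k) ≡ ⟨ 1 , pell k , pellSum k ⟩
tally-nodes zero = refl
tally-nodes (suc k) = begin
  tally (concatMap children (nodes k))       ≡⟨ tally-concatMap-children (nodes k) ⟩
  step (tally (nodes k))                     ≡⟨ cong step (tally-nodes k) ⟩
  ⟨ 1 , 1 + pell k + 2 * pellSum k , pell k + pellSum k ⟩
                                             ≡⟨ ⟨⟩-cong refl twos refl ⟩
  ⟨ 1 , pell (suc k) , pellSum (suc k) ⟩     ∎
  where
    open ≡-Reasoning
    twos : 1 + pell k + 2 * pellSum k ≡ pell (suc k)
    twos = trans (rearrange (pell k) (pellSum k)) (sym (pell-suc k))
      where
        rearrange : ∀ p s → 1 + p + 2 * s ≡ p + 2 * s + 1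
        rearrange = solve-∀

length-nodes : ∀ k → length (nodes k) * 2 ≡ pell (suc k) + pell k + 1
length-nodes k = begin
  length (nodes k) * 2            ≡⟨ cong (_* 2) (length≡total-tally (nodes k)) ⟩
  total (tally (nodes k)) * 2     ≡⟨ cong (λ t → total t * 2) (tally-nodes k) ⟩
  (1 + p + s) * 2                 ≡⟨ rearrange p s ⟩
  (p + 2 * s + 1) + p + 1         ≡⟨ cong (λ q → q + p + 1) (sym (pell-suc k)) ⟩
  pell (suc k) + p + 1            ∎
  where
    open ≡-Reasoning
    p = pell k
    s = pellSum k
    rearrange : ∀ p s → (1 + p + s) * 2 ≡ (p + 2 * s + 1) + p + 1
    rearrange = solve-∀

toFun : ∀ {n} → Perm n → ℕ → ℕ
toFun {n} (π , _) i with i <? n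
... | yes i<n = toℕ (π (fromℕ< i<n))
... | no _ = 0

toFun-< : ∀ {n} (σ : Perm n) {i} (i<n : i < n) → toFun σ i ≡ toℕ (proj₁ σ (fromℕ< i<n))
toFun-< {n} (π , _) {i} i<n with i <? n
... | yes _ = refl
... | no i≮n = ⊥-elim (i≮n i<n)

toFun-toℕ : ∀ {n} (σ : Perm n) {x : Fin n} {i} → toℕ x ≡ i → toℕ (proj₁ σ x) ≡ toFun σ i
toFun-toℕ σ {x} refl = sym (trans (toFun-< σ (toℕ<n x)) (cong (toℕ ∘ proj₁ σ) (fromℕ<-toℕ x (toℕ<n x))))

IsPerm-toFun : ∀ {n} (σ : Perm n) → IsPerm n (toFun σ)
IsPerm-toFun {n} σ@(π , injective) = bounded , injective′
  where
    bounded : ∀ i → i < n → toFun σ i < n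
    bounded i i<n = subst (_< n) (sym (toFun-< σ i<n)) (toℕ<n _)
    injective′ : ∀ i j → i < n → j < n → toFun σ i ≡ toFun σ j → i ≡ j
    injective′ i j i<n j<n eq = trans (sym (toℕ-fromℕ< i<n)) (trans (cong toℕ (injective (toℕ-injective
      (trans (sym (toFun-< σ i<n)) (trans eq (toFun-< σ j<n)))))) (toℕ-fromℕ< j<n))

fromFun : ∀ {n} (f : ℕ → ℕ) → IsPerm n f → Perm n
fromFun f (bounded , injective) = π , injective′
  where
    π = λ x → fromℕ< (bounded (toℕ x) (toℕ<n x))
    injective′ : Injective _≡_ _≡_ π
    injective′ {x} {y} eq = toℕ-injective (injective (toℕ x) (toℕ y) (toℕ<n x) (toℕ<n y)
      (trans (sym (toℕ-fromℕ< (bounded (toℕ x) (toℕ<n x)))) (trans (cong toℕ eq) (toℕ-fromℕ< (bounded (toℕ y) (toℕ<n y))))))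

toFun-fromFun : ∀ {n} (f : ℕ → ℕ) (π : IsPerm n f) → Agree n (toFun (fromFun f π)) f
toFun-fromFun f π i i<n = trans (toFun-< (fromFun f π) i<n) (trans (toℕ-fromℕ< _) (cong f (toℕ-fromℕ< i<n)))

≗ₚ⇒Agree : ∀ {n} (σ τ : Perm n) → σ ≗ₚ τ → Agree n (toFun σ) (toFun τ)
≗ₚ⇒Agree σ τ σ≗τ i i<n = trans (toFun-< σ i<n) (trans (cong toℕ (σ≗τ (fromℕ< i<n))) (sym (toFun-< τ i<n)))

Agree⇒≗ₚ : ∀ {n} (σ τ : Perm n) → Agree n (toFun σ) (toFun τ) → σ ≗ₚ τ
Agree⇒≗ₚ σ τ σ≐τ x = toℕ-injective (trans (toFun-toℕ σ refl) (trans (σ≐τ (toℕ x) (toℕ<n x)) (sym (toFun-toℕ τ refl))))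

Fishburn⇒IsFishburn : ∀ {m} (σ : Perm (suc m)) → Fishburn σ → IsFishburn (suc m) (toFun σ)
Fishburn⇒IsFishburn {m} σ fish i j i<j j<n si<n up eq =
  fish x y (subst₂ _<_ (sym x≡i) (sym (toℕ-fromℕ< j<n)) i<j)
    (subst₂ _<_ (sym (toFun-toℕ σ x≡i)) (sym (toFun-toℕ σ (cong suc (toℕ-fromℕ< (≤-pred si<n))))) up)
    (trans (toFun-toℕ σ x≡i) (trans eq (cong suc (sym (toFun-toℕ σ (toℕ-fromℕ< j<n))))))
  where
    x : Fin m
    x = fromℕ< (≤-pred si<n)
    y : Fin (suc m)
    y = fromℕ< j<n
    x≡i : toℕ (inject₁ x) ≡ i
    x≡i = trans (toℕ-inject₁ x) (toℕ-fromℕ< (≤-pred si<n))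

IsFishburn⇒Fishburn : ∀ {m} (σ : Perm (suc m)) → IsFishburn (suc m) (toFun σ) → Fishburn σ
IsFishburn⇒Fishburn {m} σ fish i j i<j up eq =
  fish (toℕ i) (toℕ j) (subst (_< toℕ j) (toℕ-inject₁ i) i<j) (toℕ<n j) (s≤s (toℕ<n i))
    (subst₂ _<_ (toFun-toℕ σ (toℕ-inject₁ i)) (toFun-toℕ σ refl) up)
    (trans (sym (toFun-toℕ σ (toℕ-inject₁ i))) (trans eq (cong suc (toFun-toℕ σ refl))))

increasing : ∀ {k} (g : Fin (suc k) → ℕ) → (∀ v → g (inject₁ v) < g (fsuc v)) → ∀ v w → v <ᶠ w → g v < g w
increasing g step fzero (fsuc fzero) _ = step fzero
increasing {suc k} g step fzero (fsuc (fsuc w)) _ =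
  <-trans (step fzero) (increasing (g ∘ fsuc) (step ∘ fsuc) fzero (fsuc w) (s≤s z≤n))
increasing {suc k} g step (fsuc v) (fsuc w) (s≤s v<w) = increasing (g ∘ fsuc) (step ∘ fsuc) v w v<w

preserves⇒⇔ : ∀ {k n} (p : Fin k → Fin k) → Injective _≡_ _≡_ p → (q : Fin k → Fin n) →
  (∀ a b → p a <ᶠ p b → q a <ᶠ q b) → ∀ a b → (p a <ᶠ p b) ⇔ (q a <ᶠ q b)
preserves⇒⇔ p p-injective q preserves a b = mk⇔ (preserves a b) reflects
  where
    reflects : q a <ᶠ q b → p a <ᶠ p b
    reflects qa<qb with <-cmp (toℕ (p a)) (toℕ (p b))
    ... | tri< pa<pb _ _ = pa<pb
    ... | tri≈ _ pa≡pb _ = ⊥-elim (<-irrefl (cong (toℕ ∘ q) (p-injective (toℕ-injective pa≡pb))) qa<qb)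
    ... | tri> _ _ pb<pa = ⊥-elim (<-asym qa<qb (preserves b a pb<pa))

-- Positions increase consecutively, and so do the values when read in the order p⁻¹.
occurrence⇒Contains : ∀ {k n} (p : Perm (suc k)) (p⁻¹ : Fin (suc k) → Fin (suc k)) →
  (∀ a → p⁻¹ (proj₁ p a) ≡ a) → (σ : Perm n) (pos : Fin (suc k) → ℕ) → (∀ a → pos a < n) →
  (∀ v → pos (inject₁ v) < pos (fsuc v)) →
  (∀ v → toFun σ (pos (p⁻¹ (inject₁ v))) < toFun σ (pos (p⁻¹ (fsuc v)))) →
  Contains p σ
occurrence⇒Contains p@(p′ , p-injective) p⁻¹ p⁻¹∘p≡id σ@(π , _) pos pos<n pos-step val-step =
  ι , ι-increasing , preserves⇒⇔ p′ p-injective (π ∘ ι) preserves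
  where
    ι : _ → Fin _
    ι a = fromℕ< (pos<n a)
    ι≡pos : ∀ a → toℕ (ι a) ≡ pos a
    ι≡pos a = toℕ-fromℕ< (pos<n a)
    ι-increasing : ∀ a b → a <ᶠ b → ι a <ᶠ ι b
    ι-increasing a b a<b = subst₂ _<_ (sym (ι≡pos a)) (sym (ι≡pos b)) (increasing pos pos-step a b a<b)
    val≡ : ∀ a → toFun σ (pos (p⁻¹ (p′ a))) ≡ toℕ (π (ι a))
    val≡ a = trans (cong (toFun σ ∘ pos) (p⁻¹∘p≡id a)) (sym (toFun-toℕ σ (ι≡pos a)))
    preserves : ∀ a b → p′ a <ᶠ p′ b → π (ι a) <ᶠ π (ι b)
    preserves a b pa<pb = subst₂ _<_ (val≡ a) (val≡ b)
      (increasing (toFun σ ∘ pos ∘ p⁻¹) val-step (p′ a) (p′ b) pa<pb)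

p321-inv-p321 : ∀ a → p321-fun (p321-fun a) ≡ a
p321-inv-p321 0F = refl
p321-inv-p321 1F = refl
p321-inv-p321 2F = refl

Avoids⇒Avoids321 : ∀ {n} (σ : Perm n) → Avoids p321 σ → Avoids321 n (toFun σ)
Avoids⇒Avoids321 {n} σ avoids i j k i<j j<k k<n v₁ v₂ = avoids
  (occurrence⇒Contains p321 p321-fun p321-inv-p321 σ pos pos<n pos-step val-step)
  where
    pos : Fin 3 → ℕ
    pos 0F = i
    pos 1F = j
    pos 2F = k
    pos<n : ∀ a → pos a < n
    pos<n 0F = <-trans i<j (<-trans j<k k<n)
    pos<n 1F = <-trans j<k k<n
    pos<n 2F = k<n
    pos-step : ∀ v → pos (inject₁ v) < pos (fsuc v)
    pos-step 0F = i<j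
    pos-step 1F = j<k
    val-step : ∀ v → toFun σ (pos (p321-fun (inject₁ v))) < toFun σ (pos (p321-fun (fsuc v)))
    val-step 0F = v₂
    val-step 1F = v₁

Avoids⇒Avoids31524 : ∀ {n} (σ : Perm n) → Avoids p31524 σ → Avoids31524 n (toFun σ)
Avoids⇒Avoids31524 {n} σ avoids a b c d e a<b b<c c<d d<e e<n v₁ v₂ v₃ v₄ = avoids
  (occurrence⇒Contains p31524 p31524-inv p31524-invl σ pos pos<n pos-step val-step)
  where
    pos : Fin 5 → ℕ
    pos 0F = a
    pos 1F = b
    pos 2F = c
    pos 3F = d
    pos 4F = e
    pos<n : ∀ x → pos x < n
    pos<n 0F = <-trans a<b (<-trans b<c (<-trans c<d (<-trans d<e e<n)))
    pos<n 1F = <-trans b<c (<-trans c<d (<-trans d<e e<n))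
    pos<n 2F = <-trans c<d (<-trans d<e e<n)
    pos<n 3F = <-trans d<e e<n
    pos<n 4F = e<n
    pos-step : ∀ v → pos (inject₁ v) < pos (fsuc v)
    pos-step 0F = a<b
    pos-step 1F = b<c
    pos-step 2F = c<d
    pos-step 3F = d<e
    val-step : ∀ v → toFun σ (pos (p31524-inv (inject₁ v))) < toFun σ (pos (p31524-inv (fsuc v)))
    val-step 0F = v₁
    val-step 1F = v₂
    val-step 2F = v₃
    val-step 3F = v₄

Avoids321⇒Avoids : ∀ {n} (σ : Perm n) → Avoids321 n (toFun σ) → Avoids p321 σ
Avoids321⇒Avoids σ avoids (ι , ι-increasing , iso) =
  avoids (toℕ (ι 0F)) (toℕ (ι 1F)) (toℕ (ι 2F)) (ι-increasing 0F 1F ≤-refl) (ι-increasing 1F 2F ≤-refl) (toℕ<n _)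
    (value< 1F 0F ≤-refl) (value< 2F 1F ≤-refl)
  where
    value< : ∀ a b → p321-fun a <ᶠ p321-fun b → toFun σ (toℕ (ι a)) < toFun σ (toℕ (ι b))
    value< a b lt = subst₂ _<_ (toFun-toℕ σ refl) (toFun-toℕ σ refl) (Equivalence.to (iso a b) lt)

Avoids31524⇒Avoids : ∀ {n} (σ : Perm n) → Avoids31524 n (toFun σ) → Avoids p31524 σ
Avoids31524⇒Avoids σ avoids (ι , ι-increasing , iso) =
  avoids (toℕ (ι 0F)) (toℕ (ι 1F)) (toℕ (ι 2F)) (toℕ (ι 3F)) (toℕ (ι 4F))
    (ι-increasing 0F 1F ≤-refl) (ι-increasing 1F 2F ≤-refl) (ι-increasing 2F 3F ≤-refl) (ι-increasing 3F 4F ≤-refl)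
    (toℕ<n _) (value< 1F 3F ≤-refl) (value< 3F 0F ≤-refl) (value< 0F 4F ≤-refl) (value< 4F 2F ≤-refl)
  where
    value< : ∀ a b → p31524-fun a <ᶠ p31524-fun b → toFun σ (toℕ (ι a)) < toFun σ (toℕ (ι b))
    value< a b lt = subst₂ _<_ (toFun-toℕ σ refl) (toFun-toℕ σ refl) (Equivalence.to (iso a b) lt)

toPerm : ∀ {k} → Node k → Perm (suc k)
toPerm N = fromFun (fun N) (isPerm N)

toPerm-inClass : ∀ {k} (N : Node k) → Fishburn (toPerm N) × Avoids p321 (toPerm N) × Avoids p31524 (toPerm N)
toPerm-inClass N with InClass-cong (Agree-sym (toFun-fromFun (fun N) (isPerm N))) (inClass N)
... | fish , av321 , av31524 =
  IsFishburn⇒Fishburn (toPerm N) fish , Avoids321⇒Avoids (toPerm N) av321 , Avoids31524⇒Avoids (toPerm N) av31524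

toPerm-distinct : ∀ {k} (N N′ : Node k) → Distinct N N′ → ¬ (toPerm N ≗ₚ toPerm N′)
toPerm-distinct N N′ N≠N′ eq = N≠N′ (Agree-trans (Agree-sym (toFun-fromFun (fun N) (isPerm N)))
  (Agree-trans (≗ₚ⇒Agree (toPerm N) (toPerm N′) eq) (toFun-fromFun (fun N′) (isPerm N′))))

toPerm-complete : ∀ {k} (σ : Perm (suc k)) → Fishburn σ × Avoids p321 σ × Avoids p31524 σ →
  Any (λ N → toPerm N ≗ₚ σ) (nodes k)
toPerm-complete {k} σ (fish , av321 , av31524) = Any.map
  (λ {N} N≐σ → Agree⇒≗ₚ (toPerm N) σ (Agree-trans (toFun-fromFun (fun N) (isPerm N)) N≐σ))
  (nodes-complete k (toFun σ) (IsPerm-toFun σ)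
    (Fishburn⇒IsFishburn σ fish , Avoids⇒Avoids321 σ av321 , Avoids⇒Avoids31524 σ av31524))

theorem4p5 : (n : ℕ) → 1 ≤ n →
    HasCount n (λ π → Fishburn π × Avoids p321 π × Avoids p31524 π)
      ((pell n + pell (n ∸ 1) + 1) / 2)
theorem4p5 zero ()
theorem4p5 (suc k) _ =
  map toPerm (nodes k) ,
  trans (length-map toPerm (nodes k)) (trans (sym (m*n/n≡m (length (nodes k)) 2)) (cong (_/ 2) (length-nodes k))) ,
  All.map⁺ (All.universal toPerm-inClass (nodes k)) ,
  AllPairs.map⁺ (AllPairs.map (λ {N} {N′} → toPerm-distinct N N′) (nodes-distinct k)) ,
  λ σ inClassσ → Any.map⁺ (toPerm-complete σ inClassσ)
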